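{- Let $G$ be an extremal uniformly $3$-connected graph on $n=3k+\ell\ge 5$ vertices, where $k\in\mathbb{N}\setminus\{1\}$ and $\ell\in\{ -1,0,1\}$, and let $j,t,p,s$ be the respective numbers of bridge operations, edge joins, primary spoke operations and secondary spoke operations involved in constructing $G$ from complete graphs on four vertices. Then: (1) $p=k-1$; (2) if $\ell=-1$, then $j=k-2$ and $t=s=0$; (3) if $\ell=0$, then $j=k-2$, $t=0$, $s=1$; (4) if $\ell=1$, then either $j=k-1$, $t=s=0$; or $j=k-2$, $t=1$, $s=0$; or $j=k-2$, $t=0$, $s=2$.
   Context: A graph on at least $4$ vertices is uniformly $3$-connected if each pair of its vertices is connected by $3$ and not more than $3$ internally disjoint paths. For a graph $G$, $\nu(G)$ is the number of vertices of $G$ whose degree equals the minimum degree of $G$. Every uniformly $3$-connected graph $G$ on $n$ vertices satisfies $\nu(G)\ge\lceil(2n+2)/3\rceil$; $G$ is called extremal if $\nu(G)=\lceil(2n+2)/3\rceil$. Bridge operation: given vertex-disjoint graphs $G_1,G_2$ and vertices $v_1\in V(G_1)$, $v_2\in V(G_2)$ of degree $3$ with $N(v_1)=\{x_1,y_1,z_1\}$, $N(v_2)=\{x_2,y_2,z_2\}$, it produces $(G_1-v_1)\cup(G_2-v_2)+x_1x_2+y_1y_2+z_1z_2$. Spoke operation: given a graph $G$ with distinct vertices $v,w,x$, $vw\in E(G)$, and $\deg(z)=3$ for all $z\ne x$, it produces $G+y-vw+vy+wy+xy$ with a new vertex $y$; it is primary if $\deg(x)=3$ and secondary if $\deg(x)>3$.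 Edge join: given a $3$-regular graph and distinct edges $st,vw$ (possibly sharing an endvertex), it produces $G+x+y-st-vw+sx+xt+vy+yw+xy$ with new vertices $x,y$. Known background: the $3$-regular $3$-connected graphs are exactly those obtainable from $K_4$ by edge joins (Tutte), and a graph is uniformly $3$-connected iff it lies in the smallest class containing all $3$-regular $3$-connected graphs and closed under the bridge operation (applied to two members) and spoke operations (applied to a member). Thus every uniformly $3$-connected graph is constructed from copies of $K_4$ by bridge operations, edge joins (on $3$-regular $3$-connected graphs) and primary/secondary spoke operations. -}

module Defs where

open import Data.Nat using (ℕ; zero; suc; _+_; _*_; _⊓_; _/_; _<_)
open import Data.Bool using (Bool; true; false; _∧_; _∨_; not; if_then_else_)
open import Data.Fin using (Fin; zero; suc; splitAt; punchIn; _≟_)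
open import Data.Nat.ListAction using (sum)
open import Data.List using (List; []; _∷_; _++_; map; foldr; length; filter; allFin)
open import Data.List.Relation.Unary.Linked using (Linked)
open import Data.List.Relation.Unary.Unique.Propositional using (Unique)
open import Data.List.Relation.Binary.Disjoint.Propositional using (Disjoint)
open import Data.Product using (Σ; _×_; _,_)
open import Data.Sum using (_⊎_; inj₁; inj₂)
open import Relation.Nullary using (¬_; does)
open import Relation.Binary.PropositionalEquality using (_≡_; _≢_)

Graph : ℕ → Set
Graph n = Fin n → Fin n → Bool

IsSimple : ∀ {n} → Graph n → Set
IsSimple {n} G = (∀ (u v : Fin n) → G u v ≡ G v u) × (∀ (u : Fin n) → G u u ≡ false)

b2n : Bool → ℕ
b2n true  = 1
b2n false = 0

deg : ∀ {n} → Graph n → Fin n → ℕ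
deg {n} G v = sum (map (λ u → b2n (G v u)) (allFin n))

-- minimum degree δ(G) (the initial value n exceeds every degree, so for
-- n ≥ 1 this is the true minimum)
minDeg : ∀ {n} → Graph n → ℕ
minDeg {n} G = foldr (λ v m → deg G v ⊓ m) n (allFin n)

ν : ∀ {n} → Graph n → ℕ
ν {n} G = length (filter (λ v → deg G v Data.Nat.≟ minDeg G) (allFin n))

⌈_/3⌉ : ℕ → ℕ
⌈ m /3⌉ = (m + 2) / 3

-- A u–v path is given by its list of interior vertices `mid`; the path is
-- u ∷ mid ++ [ v ], which must have no repeated vertex and consecutive
-- vertices adjacent.

walk : ∀ {n} → Fin n → Fin n → List (Fin n) → List (Fin n)
walk u v mid = u ∷ (mid ++ v ∷ [])

IsPath : ∀ {n} → Graph n → Fin n → Fin n → List (Fin n) → Set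
IsPath G u v mid =
  Unique (walk u v mid) × Linked (λ a b → G a b ≡ true) (walk u v mid)

HasDisjointPaths : ∀ {n} → Graph n → ℕ → Fin n → Fin n → Set
HasDisjointPaths {n} G k u v =
  Σ (Fin k → List (Fin n)) λ P →
    (∀ i → IsPath G u v (P i)) ×
    (∀ i j → i ≢ j → (P i ≢ P j) × Disjoint (P i) (P j))

UniformlyThreeConnected : ∀ {n} → Graph n → Set
UniformlyThreeConnected {n} G =
  (4 Data.Nat.≤ n) ×
  (∀ (u v : Fin n) → u ≢ v →
     HasDisjointPaths G 3 u v × ¬ HasDisjointPaths G 4 u v)

Extremal : ∀ {n} → Graph n → Set
Extremal {n} G = UniformlyThreeConnected G × ν G ≡ ⌈ 2 * n + 2 /3⌉

eqb : ∀ {n} → Fin n → Fin n → Bool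
eqb a b = does (a ≟ b)

samePair : ∀ {n} → Fin n → Fin n → Fin n → Fin n → Bool
samePair a b c d = (eqb a c ∧ eqb b d) ∨ (eqb a d ∧ eqb b c)

K4 : Graph 4
K4 i j = not (eqb i j)

-- Bridge: vertices of the result are (G₁ - v₁) followed by (G₂ - v₂),
-- via splitAt and punchIn.
bridgeGraph : ∀ {a b} →
  (G₁ : Graph (suc a)) (v₁ x₁ y₁ z₁ : Fin (suc a)) →
  (G₂ : Graph (suc b)) (v₂ x₂ y₂ z₂ : Fin (suc b)) →
  Graph (a + b)
bridgeGraph {a} {b} G₁ v₁ x₁ y₁ z₁ G₂ v₂ x₂ y₂ z₂ i j =
  go (splitAt a i) (splitAt a j)
  where
  match : Fin (suc a) → Fin (suc b) → Bool
  match p q = (eqb p x₁ ∧ eqb q x₂) ∨ (eqb p y₁ ∧ eqb q y₂) ∨ (eqb p z₁ ∧ eqb q z₂)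
  go : Fin a ⊎ Fin b → Fin a ⊎ Fin b → Bool
  go (inj₁ p) (inj₁ q) = G₁ (punchIn v₁ p) (punchIn v₁ q)
  go (inj₂ p) (inj₂ q) = G₂ (punchIn v₂ p) (punchIn v₂ q)
  go (inj₁ p) (inj₂ q) = match (punchIn v₁ p) (punchIn v₂ q)
  go (inj₂ p) (inj₁ q) = match (punchIn v₁ q) (punchIn v₂ p)

-- Spoke: new vertex y is `zero`, old vertex c is `suc c`.
spokeGraph : ∀ {n} → Graph n → (v w x : Fin n) → Graph (suc n)
spokeGraph G v w x zero    zero    = false
spokeGraph G v w x zero    (suc c) = eqb c v ∨ eqb c w ∨ eqb c x
spokeGraph G v w x (suc c) zero    = eqb c v ∨ eqb c w ∨ eqb c x
spokeGraph G v w x (suc a) (suc b) = G a b ∧ not (samePair a b v w)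

-- Edge join: new vertices x = zero, y = suc zero; old c is suc (suc c).
edgeJoinGraph : ∀ {n} → Graph n → (s t v w : Fin n) → Graph (suc (suc n))
edgeJoinGraph G s t v w zero          zero          = false
edgeJoinGraph G s t v w zero          (suc zero)    = true
edgeJoinGraph G s t v w (suc zero)    zero          = true
edgeJoinGraph G s t v w (suc zero)    (suc zero)    = false
edgeJoinGraph G s t v w zero          (suc (suc c)) = eqb c s ∨ eqb c t
edgeJoinGraph G s t v w (suc (suc c)) zero          = eqb c s ∨ eqb c t
edgeJoinGraph G s t v w (suc zero)    (suc (suc c)) = eqb c v ∨ eqb c w
edgeJoinGraph G s t v w (suc (suc c)) (suc zero)    = eqb c v ∨ eqb c w
edgeJoinGraph G s t v w (suc (suc a)) (suc (suc b)) =
  G a b ∧ not (samePair a b s t) ∧ not (samePair a b v w)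

Iso : ∀ {n} → Graph n → Graph n → Set
Iso {n} G H =
  Σ (Fin n → Fin n) λ f → Σ (Fin n → Fin n) λ g →
    (∀ i → g (f i) ≡ i) × (∀ i → f (g i) ≡ i) ×
    (∀ i j → H (f i) (f j) ≡ G i j)

Nbhd3 : ∀ {n} → Graph n → (v x y z : Fin n) → Set
Nbhd3 G v x y z =
  deg G v ≡ 3 × x ≢ y × x ≢ z × y ≢ z ×
  (∀ u → (G v u ≡ true → (u ≡ x ⊎ u ≡ y ⊎ u ≡ z)) ×
         ((u ≡ x ⊎ u ≡ y ⊎ u ≡ z) → G v u ≡ true))

Cubic : ∀ {n} → Graph n → Set
Cubic G = ∀ z → deg G z ≡ 3

data Construction : (n : ℕ) → Graph n → (j t p s : ℕ) → Set where
  k4 : Construction 4 K4 0 0 0 0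
  iso : ∀ {n G H j t p s} → Construction n G j t p s → Iso G H →
        Construction n H j t p s
  bridge : ∀ {a b G₁ G₂ j₁ t₁ p₁ s₁ j₂ t₂ p₂ s₂} →
    Construction (suc a) G₁ j₁ t₁ p₁ s₁ →
    Construction (suc b) G₂ j₂ t₂ p₂ s₂ →
    (v₁ x₁ y₁ z₁ : Fin (suc a)) → Nbhd3 G₁ v₁ x₁ y₁ z₁ →
    (v₂ x₂ y₂ z₂ : Fin (suc b)) → Nbhd3 G₂ v₂ x₂ y₂ z₂ →
    Construction (a + b) (bridgeGraph G₁ v₁ x₁ y₁ z₁ G₂ v₂ x₂ y₂ z₂)
      (suc (j₁ + j₂)) (t₁ + t₂) (p₁ + p₂) (s₁ + s₂)
  edgeJoin : ∀ {n G j t p s} → Construction n G j t p s → Cubic G →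
    (a b c d : Fin n) → G a b ≡ true → G c d ≡ true →
    samePair a b c d ≡ false →
    Construction (suc (suc n)) (edgeJoinGraph G a b c d) j (suc t) p s
  primarySpoke : ∀ {n G j t p s} → Construction n G j t p s →
    (v w x : Fin n) → v ≢ w → v ≢ x → w ≢ x → G v w ≡ true →
    (∀ z → z ≢ x → deg G z ≡ 3) → deg G x ≡ 3 →
    Construction (suc n) (spokeGraph G v w x) j t (suc p) s
  secondarySpoke : ∀ {n G j t p s} → Construction n G j t p s →
    (v w x : Fin n) → v ≢ w → v ≢ x → w ≢ x → G v w ≡ true →
    (∀ z → z ≢ x → deg G z ≡ 3) → 3 < deg G x →
    Construction (suc n) (spokeGraph G v w x) j t p (suc s)

-- Along any construction every vertex has degree at least 3, and a vertex of degree greater than 3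
-- arises only as the hub x of a primary spoke: a bridge deletes two vertices of degree 3 and keeps
-- all other degrees, an edge join acts on a cubic graph, a secondary spoke raises an already large
-- degree, and the new vertex of a spoke has degree 3. Hence ν(G) counts the vertices of degree 3 and
-- n − ν(G) = p. Counting vertices gives n = 4 + 2j + 2t + p + s, and p ≤ j + 1 because a primary
-- spoke is applied only to a cubic graph. For extremal G with n = 3k + ℓ this forces p = k − 1 and
-- 2(j − (k − 2)) + 2t + s = ℓ + 1, whose solutions are the listed cases. Of the hypotheses on G only
-- the value of ν is used; simplicity follows from the construction.
module Submission where

open import Defs

open import Data.Bool using (Bool; true; false; _∧_; _∨_; not)
open import Data.Bool.Properties using (T-≡; ∧-comm; ∨-comm; ∧-assoc; ∨-assoc; ∧-zeroʳ; ∧-identityʳ)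
open import Data.Empty using (⊥-elim)
open import Data.Fin using (Fin; zero; suc; punchIn; _↑ˡ_; _↑ʳ_; splitAt)
import Data.Fin as Fin
open import Data.Fin.Permutation using (Permutation; permutation; _⟨$⟩ʳ_)
open import Data.Fin.Properties using (punchInᵢ≢i; splitAt-↑ˡ; splitAt-↑ʳ; join-splitAt)
open import Data.Integer using (ℤ; +_; -1ℤ; 0ℤ; 1ℤ)
import Data.Integer
import Data.Integer as ℤ
import Data.Integer.Properties as ℤ
open import Data.Integer.Solver renaming (module +-*-Solver to ℤ-Solver)
import Data.List as List
open import Data.List using (_∷_; [])
open import Data.List.Membership.Propositional using (_∈_)
open import Data.List.Membership.Propositional.Properties using (∈-allFin)
open import Data.List.Properties using (map-tabulate)
open import Data.List.Relation.Unary.Any using (here; there)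
import Data.Nat
open import Data.Nat
  using (ℕ; zero; suc; _+_; _*_; _∸_; _/_; _⊓_; _≤_; _<_; _≡ᵇ_; _≟_; z≤n; s≤s; s≤s⁻¹; NonZero)
open import Data.Nat.DivMod using (+-distrib-/-∣ʳ; m<n⇒m/n≡0; m*n/n≡m; /-congˡ)
open import Data.Nat.Divisibility using (divides-refl)
import Data.Nat.ListAction as ListAction
open import Data.Nat.Properties
  using ( +-assoc; +-comm; +-suc; +-identityʳ; +-cancelˡ-≡; suc-injective; +-mono-≤; +-monoˡ-≤
        ; ≤-reflexive; ≤-trans; ≤-antisym; <⇒≢; >⇒≢; ≤⇒≯; n≢0⇒n>0; ≡ᵇ⇒≡
        ; m≤m+n; m≤n+m; m<n+m; m∸n≤m; m≤n⇒∃[o]m+o≡n; ⊓-glb; m⊓n≤m; m⊓n≤n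
        ; +-0-commutativeMonoid; +-commutativeSemigroup )
open import Data.Nat.Solver using (module +-*-Solver)
open +-*-Solver using (solve; _:+_; _:*_; _:=_; con)
open import Data.Product using (_×_; _,_; proj₁; proj₂; ∃-syntax)
open import Data.Sum using (_⊎_; inj₁; inj₂)
open import Function using (_∘_; mk⇔; Equivalence)
open import Level using (0ℓ)
open import Relation.Binary.PropositionalEquality
open import Relation.Nullary using (yes; no; does)
open import Relation.Nullary.Decidable using (dec-true; dec-false; does-⇔)
open import Relation.Unary using (Pred; Decidable)

open import Algebra.Properties.CommutativeMonoid.Sum +-0-commutativeMonoid
  using (sum; sum-cong-≗; sum-remove; ∑-distrib-+; ∑-permute)
open import Algebra.Properties.CommutativeSemigroup +-commutativeSemigroup using (interchange)

eqb-refl : ∀ {n} (a : Fin n) → eqb a a ≡ true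
eqb-refl a = dec-true (a Fin.≟ a) refl

eqb-≢ : ∀ {n} {a b : Fin n} → a ≢ b → eqb a b ≡ false
eqb-≢ {a = a} {b} = dec-false (a Fin.≟ b)

eqb-true : ∀ {n} {a b : Fin n} → eqb a b ≡ true → a ≡ b
eqb-true {a = a} {b} eq with a Fin.≟ b
... | yes a≡b = a≡b

eqb-comm : ∀ {n} (a b : Fin n) → eqb a b ≡ eqb b a
eqb-comm a b = does-⇔ (mk⇔ sym sym) (a Fin.≟ b) (b Fin.≟ a)

eqb-disjoint : ∀ {n} {a b : Fin n} → a ≢ b → ∀ u → eqb u a ∧ eqb u b ≡ false
eqb-disjoint {a = a} {b} a≢b u with u Fin.≟ a
... | yes refl = eqb-≢ a≢b
... | no _ = refl

samePair-true : ∀ {n} {a b c d : Fin n} → samePair a b c d ≡ true → (a ≡ c × b ≡ d) ⊎ (a ≡ d × b ≡ c)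
samePair-true {a = a} {b} {c} {d} eq with eqb a c in ac | eqb b d in bd | eqb a d in ad | eqb b c in bc
... | true  | true  | _     | _    = inj₁ (eqb-true ac , eqb-true bd)
... | true  | false | true  | true = inj₂ (eqb-true ad , eqb-true bc)
... | false | _     | true  | true = inj₂ (eqb-true ad , eqb-true bc)

samePair-swapˡ : ∀ {n} (a b c d : Fin n) → samePair a b c d ≡ samePair b a c d
samePair-swapˡ a b c d = begin
  (eqb a c ∧ eqb b d) ∨ (eqb a d ∧ eqb b c)  ≡⟨ ∨-comm (eqb a c ∧ eqb b d) _ ⟩
  (eqb a d ∧ eqb b c) ∨ (eqb a c ∧ eqb b d)  ≡⟨ cong₂ _∨_ (∧-comm (eqb a d) _) (∧-comm (eqb a c) _) ⟩
  (eqb b c ∧ eqb a d) ∨ (eqb b d ∧ eqb a c)  ∎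
  where open ≡-Reasoning

samePair-comm : ∀ {n} (a b c d : Fin n) → samePair a b c d ≡ samePair c d a b
samePair-comm a b c d rewrite eqb-comm a c | eqb-comm b d | eqb-comm a d | eqb-comm b c =
  cong ((eqb c a ∧ eqb d b) ∨_) (∧-comm (eqb d a) (eqb c b))

b2n-∨ : ∀ a b → a ∧ b ≡ false → b2n (a ∨ b) ≡ b2n a + b2n b
b2n-∨ true  false _ = refl
b2n-∨ false _     _ = refl

∧-∧-false : ∀ a b c d → a ∧ c ≡ false → (a ∧ b) ∧ (c ∧ d) ≡ false
∧-∧-false true  b true  d ()
∧-∧-false true  b false d _ = ∧-zeroʳ b
∧-∧-false false b c     d _ = refl

∨-∧-false : ∀ a b c → a ∧ c ≡ false → b ∧ c ≡ false → (a ∨ b) ∧ c ≡ false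
∨-∧-false true  _ _ ac≡false _       = ac≡false
∨-∧-false false _ _ _       bc≡false = bc≡false

b2n-∨-∨ : ∀ a b c → a ∧ c ≡ false → b ∧ c ≡ false → b2n (a ∨ b ∨ c) ≡ b2n (a ∨ b) + b2n c
b2n-∨-∨ a b c ac≡false bc≡false =
  trans (cong b2n (sym (∨-assoc a b c))) (b2n-∨ (a ∨ b) c (∨-∧-false a b c ac≡false bc≡false))

count : ∀ {n} → (Fin n → Bool) → ℕ
count f = sum (b2n ∘ f)

count-cong : ∀ {n} {f g : Fin n → Bool} → f ≗ g → count f ≡ count g
count-cong f≗g = sum-cong-≗ (cong b2n ∘ f≗g)

count-remove : ∀ {n} (f : Fin (suc n) → Bool) i → count f ≡ b2n (f i) + count (f ∘ punchIn i)
count-remove f i = sum-remove {i = i} (b2n ∘ f)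

count-punchIn-false : ∀ {n} {f : Fin (suc n) → Bool} v → f v ≡ false → count (f ∘ punchIn v) ≡ count f
count-punchIn-false {f = f} v fv≡false =
  sym (trans (count-remove f v) (cong (λ b → b2n b + count (f ∘ punchIn v)) fv≡false))

count-splitAt : ∀ m {n} (f : Fin (m + n) → Bool) →
  count f ≡ count (λ i → f (i ↑ˡ n)) + count (λ j → f (m ↑ʳ j))
count-splitAt zero    f = refl
count-splitAt (suc m) f =
  trans (cong (_+_ (b2n (f zero))) (count-splitAt m (f ∘ suc))) (sym (+-assoc (b2n (f zero)) _ _))

splitAt-elim : ∀ {m n} {P : Fin (m + n) → Set} → (∀ i → P (i ↑ˡ n)) → (∀ j → P (m ↑ʳ j)) → ∀ u → P u
splitAt-elim {m} {n} {P} left right u = subst P (join-splitAt m n u) (by-side (splitAt m u))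
  where
  by-side : ∀ s → P (Fin.join m n s)
  by-side (inj₁ i) = left i
  by-side (inj₂ j) = right j

count-permute : ∀ {n} (f : Fin n → Bool) (π : Permutation n n) → count f ≡ count (λ i → f (π ⟨$⟩ʳ i))
count-permute f π = ∑-permute (b2n ∘ f) π

count-false : ∀ {n} {f : Fin n → Bool} → (∀ u → f u ≡ false) → count f ≡ 0
count-false {zero}          _ = refl
count-false {suc n} {f} f≡false rewrite f≡false zero = count-false (f≡false ∘ suc)

count-true : ∀ {n} {f : Fin n → Bool} → (∀ u → f u ≡ true) → count f ≡ n
count-true {zero}          _ = refl
count-true {suc n} {f} f≡true rewrite f≡true zero = cong suc (count-true (f≡true ∘ suc))

count-only : ∀ {n} {f : Fin n → Bool} q → (∀ u → u ≢ q → f u ≡ false) → count f ≡ b2n (f q)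
count-only {suc n} {f} q off = begin
  count f                            ≡⟨ count-remove f q ⟩
  b2n (f q) + count (f ∘ punchIn q)  ≡⟨ cong (_+_ (b2n (f q))) (count-false (λ i → off _ (punchInᵢ≢i q i))) ⟩
  b2n (f q) + 0                      ≡⟨ +-identityʳ _ ⟩
  b2n (f q)                          ∎
  where open ≡-Reasoning

count-∧-≟ : ∀ {n} (a : Bool) (q : Fin n) → count (λ u → a ∧ eqb u q) ≡ b2n a
count-∧-≟ a q = begin
  count (λ u → a ∧ eqb u q)  ≡⟨ count-only q (λ u u≢q → trans (cong (a ∧_) (eqb-≢ u≢q)) (∧-zeroʳ a)) ⟩
  b2n (a ∧ eqb q q)          ≡⟨ cong (λ b → b2n (a ∧ b)) (eqb-refl q) ⟩
  b2n (a ∧ true)             ≡⟨ cong b2n (∧-identityʳ a) ⟩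
  b2n a                      ∎
  where open ≡-Reasoning

count-≟ : ∀ {n} (q : Fin n) → count (λ u → eqb u q) ≡ 1
count-≟ = count-∧-≟ true

count-∨ : ∀ {n} (f g : Fin n → Bool) → (∀ u → f u ∧ g u ≡ false) →
  count (λ u → f u ∨ g u) ≡ count f + count g
count-∨ f g disjoint =
  trans (sum-cong-≗ (λ u → b2n-∨ (f u) (g u) (disjoint u))) (∑-distrib-+ (b2n ∘ f) (b2n ∘ g))

count-≟-∨ : ∀ {n} {q r : Fin n} → q ≢ r → count (λ u → eqb u q ∨ eqb u r) ≡ 2
count-≟-∨ {q = q} {r} q≢r =
  trans (count-∨ (λ u → eqb u q) (λ u → eqb u r) (eqb-disjoint q≢r)) (cong₂ _+_ (count-≟ q) (count-≟ r))

count-∧-split : ∀ {n} (f g : Fin n → Bool) →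
  count f ≡ count (λ u → f u ∧ not (g u)) + count (λ u → f u ∧ g u)
count-∧-split f g = trans (count-cong (λ u → split (f u) (g u))) (count-∨ _ _ (λ u → disjoint (f u) (g u)))
  where
  split : ∀ a b → a ≡ (a ∧ not b) ∨ (a ∧ b)
  split true  true  = refl
  split true  false = refl
  split false _     = refl
  disjoint : ∀ a b → (a ∧ not b) ∧ (a ∧ b) ≡ false
  disjoint true  true  = refl
  disjoint true  false = refl
  disjoint false _     = refl

count-agree-off : ∀ {n} {f g : Fin n → Bool} x → (∀ u → u ≢ x → f u ≡ g u) →
  count f + b2n (g x) ≡ count g + b2n (f x)
count-agree-off {suc n} {f} {g} x agree = begin
  count f + b2n (g x)                            ≡⟨ cong (_+ b2n (g x)) (count-remove f x) ⟩
  b2n (f x) + count (f ∘ punchIn x) + b2n (g x)  ≡⟨ cong (λ m → b2n (f x) + m + b2n (g x)) off ⟩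
  b2n (f x) + count (g ∘ punchIn x) + b2n (g x)
    ≡⟨ solve 3 (λ a m b → a :+ m :+ b := b :+ m :+ a) refl (b2n (f x)) _ (b2n (g x)) ⟩
  b2n (g x) + count (g ∘ punchIn x) + b2n (f x)  ≡⟨ cong (_+ b2n (f x)) (count-remove g x) ⟨
  count g + b2n (f x)                            ∎
  where
  open ≡-Reasoning
  off : count (f ∘ punchIn x) ≡ count (g ∘ punchIn x)
  off = count-cong (λ i → agree _ (punchInᵢ≢i x i))

count-pos : ∀ {n} (f : Fin n → Bool) → 0 < count f → ∃[ u ] f u ≡ true
count-pos {suc n} f 0<count with f zero in f[0]
... | true  = zero , f[0]
... | false = let (u , f[u]) = count-pos (f ∘ suc) 0<count in suc u , f[u]

sum-tabulate : ∀ {n} (g : Fin n → ℕ) → ListAction.sum (List.tabulate g) ≡ sum g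
sum-tabulate {zero}  g = refl
sum-tabulate {suc n} g = cong (_+_ (g zero)) (sum-tabulate (g ∘ suc))

sum-map-allFin : ∀ {n} (g : Fin n → ℕ) → ListAction.sum (List.map g (List.allFin n)) ≡ sum g
sum-map-allFin {n} g = trans (cong ListAction.sum (map-tabulate {n = n} (λ i → i) g)) (sum-tabulate g)

deg≡count : ∀ {n} (G : Graph n) v → deg G v ≡ count (G v)
deg≡count G v = sum-map-allFin (b2n ∘ G v)

adjacent⇒≢ : ∀ {n} {G : Graph n} → IsSimple G → ∀ {a b} → G a b ≡ true → a ≢ b
adjacent⇒≢ {G = G} (_ , irreflexive) {a} Gab≡true refl with trans (sym Gab≡true) (irreflexive a)
... | ()

-- On old vertices, spokeGraph G v w x is removeEdge G v w, and edgeJoinGraph G s t v w is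
-- removeEdge (removeEdge G s t) v w up to associativity of _∧_.
removeEdge : ∀ {n} → Graph n → Fin n → Fin n → Graph n
removeEdge G s t a b = G a b ∧ not (samePair a b s t)

removeEdge-simple : ∀ {n} {G : Graph n} s t → IsSimple G → IsSimple (removeEdge G s t)
removeEdge-simple {G = G} s t (symmetric , irreflexive) =
  (λ a b → cong₂ (λ e p → e ∧ not p) (symmetric a b) (samePair-swapˡ a b s t)) ,
  (λ a → cong (_∧ _) (irreflexive a))

count-samePair : ∀ {n} {s t : Fin n} → s ≢ t → ∀ c →
  count (λ b → samePair c b s t) ≡ b2n (eqb c s ∨ eqb c t)
count-samePair {s = s} {t} s≢t c = begin
  count (λ b → (eqb c s ∧ eqb b t) ∨ (eqb c t ∧ eqb b s))
    ≡⟨ count-∨ (λ b → eqb c s ∧ eqb b t) (λ b → eqb c t ∧ eqb b s)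
               (λ b → ∧-∧-false (eqb c s) _ (eqb c t) _ (eqb-disjoint s≢t c)) ⟩
  count (λ b → eqb c s ∧ eqb b t) + count (λ b → eqb c t ∧ eqb b s)
    ≡⟨ cong₂ _+_ (count-∧-≟ (eqb c s) t) (count-∧-≟ (eqb c t) s) ⟩
  b2n (eqb c s) + b2n (eqb c t)
    ≡⟨ b2n-∨ (eqb c s) (eqb c t) (eqb-disjoint s≢t c) ⟨
  b2n (eqb c s ∨ eqb c t) ∎
  where open ≡-Reasoning

deg-removeEdge : ∀ {n} {G : Graph n} → IsSimple G → ∀ {s t} → G s t ≡ true → ∀ c →
  deg G c ≡ deg (removeEdge G s t) c + b2n (eqb c s ∨ eqb c t)
deg-removeEdge {G = G} simple@(symmetric , _) {s} {t} Gst≡true c = begin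
  deg G c      ≡⟨ deg≡count G c ⟩
  count (G c)  ≡⟨ count-∧-split (G c) (λ b → samePair c b s t) ⟩
  count (removeEdge G s t c) + count (λ b → G c b ∧ samePair c b s t)
    ≡⟨ cong₂ _+_ (sym (deg≡count (removeEdge G s t) c)) (count-cong on-edge) ⟩
  deg (removeEdge G s t) c + count (λ b → samePair c b s t)
    ≡⟨ cong (_+_ (deg (removeEdge G s t) c)) (count-samePair (adjacent⇒≢ simple Gst≡true) c) ⟩
  deg (removeEdge G s t) c + b2n (eqb c s ∨ eqb c t)
    ∎
  where
  open ≡-Reasoning
  on-edge : ∀ b → G c b ∧ samePair c b s t ≡ samePair c b s t
  on-edge b with samePair c b s t in eq
  ... | false = ∧-zeroʳ (G c b)
  ... | true with samePair-true {a = c} {b} {s} {t} eq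
  ...   | inj₁ (refl , refl) = trans (∧-identityʳ _) Gst≡true
  ...   | inj₂ (refl , refl) = trans (∧-identityʳ _) (trans (symmetric t s) Gst≡true)

#deg3 : ∀ {n} → Graph n → ℕ
#deg3 G = count (λ v → deg G v ≡ᵇ 3)

record Invariant {n} (G : Graph n) (p : ℕ) : Set where
  field
    simple    : IsSimple G
    3≤deg     : ∀ v → 3 ≤ deg G v
    #deg3+p≡n : #deg3 G + p ≡ n

cubic⇒invariant : ∀ {n} {G : Graph n} → IsSimple G → Cubic G → Invariant G 0
cubic⇒invariant simple cubic = record
  { simple    = simple
  ; 3≤deg     = λ v → ≤-reflexive (sym (cubic v))
  ; #deg3+p≡n = trans (+-identityʳ _) (count-true (λ v → cong (_≡ᵇ 3) (cubic v)))
  }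

invariant-cubic⇒p≡0 : ∀ {n} {G : Graph n} {p} → Invariant G p → Cubic G → p ≡ 0
invariant-cubic⇒p≡0 {n} {G} {p} inv cubic = +-cancelˡ-≡ n p 0 (begin
  n + p          ≡⟨ cong (_+ p) (sym (count-true (λ v → cong (_≡ᵇ 3) (cubic v)))) ⟩
  #deg3 G + p    ≡⟨ Invariant.#deg3+p≡n inv ⟩
  n              ≡⟨ +-identityʳ n ⟨
  n + 0          ∎)
  where open ≡-Reasoning

K4-simple : IsSimple K4
K4-simple = (λ u v → cong not (eqb-comm u v)) , (λ u → cong not (eqb-refl u))

K4-cubic : Cubic K4
K4-cubic zero                   = refl
K4-cubic (suc zero)             = refl
K4-cubic (suc (suc zero))       = refl
K4-cubic (suc (suc (suc zero))) = refl

deg-iso : ∀ {n} {G H : Graph n} (G≅H : Iso G H) → ∀ i → deg H (proj₁ G≅H i) ≡ deg G i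
deg-iso {G = G} {H} (f , g , gf , fg , hom) i = begin
  deg H (f i)                   ≡⟨ deg≡count H (f i) ⟩
  count (H (f i))               ≡⟨ count-permute (H (f i)) (permutation f g fg gf) ⟩
  count (λ j → H (f i) (f j))   ≡⟨ count-cong (hom i) ⟩
  count (G i)                   ≡⟨ deg≡count G i ⟨
  deg G i                       ∎
  where open ≡-Reasoning

iso-invariant : ∀ {n} {G H : Graph n} {p} → Iso G H → Invariant G p → Invariant H p
iso-invariant {G = G} {H} {p} G≅H@(f , g , gf , fg , hom) inv = record
  { simple    = symmetric , irreflexive
  ; 3≤deg     = λ v → ≤-trans (3≤deg (g v)) (≤-reflexive (sym (deg-at-g v)))
  ; #deg3+p≡n = trans (cong (_+ p) #deg3-iso) #deg3+p≡n
  }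
  where
  open Invariant inv using (3≤deg; #deg3+p≡n)
  at-g : ∀ a b → H a b ≡ G (g a) (g b)
  at-g a b = trans (cong₂ H (sym (fg a)) (sym (fg b))) (hom (g a) (g b))
  symmetric : ∀ a b → H a b ≡ H b a
  symmetric a b = trans (at-g a b) (trans (proj₁ (Invariant.simple inv) _ _) (sym (at-g b a)))
  irreflexive : ∀ a → H a a ≡ false
  irreflexive a = trans (at-g a a) (proj₂ (Invariant.simple inv) _)
  deg-at-g : ∀ v → deg H v ≡ deg G (g v)
  deg-at-g v = trans (cong (deg H) (sym (fg v))) (deg-iso {G = G} {H} G≅H (g v))
  #deg3-iso : #deg3 H ≡ #deg3 G
  #deg3-iso = trans (count-permute _ (permutation f g fg gf))
                    (count-cong (cong (_≡ᵇ 3) ∘ deg-iso {G = G} {H} G≅H))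

spoke-simple : ∀ {n} {G : Graph n} v w x → IsSimple G → IsSimple (spokeGraph G v w x)
spoke-simple {G = G} v w x simple = symmetric , irreflexive
  where
  symmetric : ∀ a b → spokeGraph G v w x a b ≡ spokeGraph G v w x b a
  symmetric zero    zero    = refl
  symmetric zero    (suc b) = refl
  symmetric (suc a) zero    = refl
  symmetric (suc a) (suc b) = proj₁ (removeEdge-simple v w simple) a b
  irreflexive : ∀ a → spokeGraph G v w x a a ≡ false
  irreflexive zero    = refl
  irreflexive (suc a) = proj₂ (removeEdge-simple v w simple) a

module _ {n} {G : Graph n} (simple : IsSimple G) {v w x : Fin n}
         (v≢w : v ≢ w) (v≢x : v ≢ x) (w≢x : w ≢ x) (Gvw≡true : G v w ≡ true) where

  private
    G′ = spokeGraph G v w x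

  deg-spoke-new : deg G′ zero ≡ 3
  deg-spoke-new = begin
    deg G′ zero                                  ≡⟨ deg≡count G′ zero ⟩
    count (λ c → eqb c v ∨ eqb c w ∨ eqb c x)    ≡⟨ count-cong (λ c → sym (∨-assoc (eqb c v) _ _)) ⟩
    count (λ c → (eqb c v ∨ eqb c w) ∨ eqb c x)
      ≡⟨ count-∨ _ (λ c → eqb c x)
                 (λ c → ∨-∧-false (eqb c v) _ _ (eqb-disjoint v≢x c) (eqb-disjoint w≢x c)) ⟩
    count (λ c → eqb c v ∨ eqb c w) + count (λ c → eqb c x)
      ≡⟨ cong₂ _+_ (count-≟-∨ v≢w) (count-≟ x) ⟩
    3 ∎
    where open ≡-Reasoning

  deg-spoke-old : ∀ c → deg G′ (suc c) ≡ deg G c + b2n (eqb c x)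
  deg-spoke-old c = begin
    deg G′ (suc c)
      ≡⟨ deg≡count G′ (suc c) ⟩
    b2n (eqb c v ∨ eqb c w ∨ eqb c x) + count (removeEdge G v w c)
      ≡⟨ cong₂ _+_ (b2n-∨-∨ (eqb c v) _ _ (eqb-disjoint v≢x c) (eqb-disjoint w≢x c))
                   (sym (deg≡count (removeEdge G v w) c)) ⟩
    b2n (eqb c v ∨ eqb c w) + b2n (eqb c x) + deg (removeEdge G v w) c
      ≡⟨ solve 3 (λ e x d → e :+ x :+ d := d :+ e :+ x) refl (b2n (eqb c v ∨ eqb c w)) _ _ ⟩
    deg (removeEdge G v w) c + b2n (eqb c v ∨ eqb c w) + b2n (eqb c x)
      ≡⟨ cong (_+ b2n (eqb c x)) (deg-removeEdge simple Gvw≡true c) ⟨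
    deg G c + b2n (eqb c x)
      ∎
    where open ≡-Reasoning

  #deg3-spoke : 3 ≤ deg G x → #deg3 G′ + b2n (deg G x ≡ᵇ 3) ≡ suc (#deg3 G)
  #deg3-spoke 3≤deg[x] = begin
    #deg3 G′ + b2n (H x)
      ≡⟨⟩
    b2n (deg G′ zero ≡ᵇ 3) + count (λ c → deg G′ (suc c) ≡ᵇ 3) + b2n (H x)
      ≡⟨ cong₂ (λ d m → b2n (d ≡ᵇ 3) + m + b2n (H x))
               deg-spoke-new (count-cong (cong (_≡ᵇ 3) ∘ deg-spoke-old)) ⟩
    suc (count F + b2n (H x))  ≡⟨ cong suc (count-agree-off x F≡H-off-x) ⟩
    suc (count H + b2n (F x))  ≡⟨ cong (λ b → suc (count H + b2n b)) F[x]≡false ⟩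
    suc (count H + 0)          ≡⟨ cong suc (+-identityʳ _) ⟩
    suc (#deg3 G)              ∎
    where
    open ≡-Reasoning
    F H : Fin n → Bool
    F c = deg G c + b2n (eqb c x) ≡ᵇ 3
    H c = deg G c ≡ᵇ 3
    F≡H-off-x : ∀ u → u ≢ x → F u ≡ H u
    F≡H-off-x u u≢x =
      trans (cong (λ b → deg G u + b2n b ≡ᵇ 3) (eqb-≢ u≢x)) (cong (_≡ᵇ 3) (+-identityʳ (deg G u)))
    F[x]≡false : F x ≡ false
    F[x]≡false = trans (cong (λ b → deg G x + b2n b ≡ᵇ 3) (eqb-refl x))
                       (dec-false (deg G x + 1 ≟ 3) (<⇒≢ (+-monoˡ-≤ 1 3≤deg[x]) ∘ sym))

  spoke-invariant : ∀ {p} → Invariant G p → Invariant G′ (b2n (deg G x ≡ᵇ 3) + p)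
  spoke-invariant {p} inv = record
    { simple    = spoke-simple v w x simple
    ; 3≤deg     = 3≤deg′
    ; #deg3+p≡n = begin
        #deg3 G′ + (b2n (deg G x ≡ᵇ 3) + p)  ≡⟨ +-assoc (#deg3 G′) _ p ⟨
        #deg3 G′ + b2n (deg G x ≡ᵇ 3) + p    ≡⟨ cong (_+ p) (#deg3-spoke (3≤deg x)) ⟩
        suc (#deg3 G + p)                    ≡⟨ cong suc #deg3+p≡n ⟩
        suc n                                ∎
    }
    where
    open ≡-Reasoning
    open Invariant inv using (3≤deg; #deg3+p≡n)
    3≤deg′ : ∀ u → 3 ≤ deg G′ u
    3≤deg′ zero    = ≤-reflexive (sym deg-spoke-new)
    3≤deg′ (suc c) = ≤-trans (3≤deg c) (≤-trans (m≤m+n _ _) (≤-reflexive (sym (deg-spoke-old c))))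

edgeJoin-simple : ∀ {n} {G : Graph n} s t v w → IsSimple G → IsSimple (edgeJoinGraph G s t v w)
edgeJoin-simple {G = G} s t v w (symmetric , irreflexive) = symmetric′ , irreflexive′
  where
  G′ = edgeJoinGraph G s t v w
  symmetric′ : ∀ a b → G′ a b ≡ G′ b a
  symmetric′ zero          zero          = refl
  symmetric′ zero          (suc zero)    = refl
  symmetric′ zero          (suc (suc b)) = refl
  symmetric′ (suc zero)    zero          = refl
  symmetric′ (suc zero)    (suc zero)    = refl
  symmetric′ (suc zero)    (suc (suc b)) = refl
  symmetric′ (suc (suc a)) zero          = refl
  symmetric′ (suc (suc a)) (suc zero)    = refl
  symmetric′ (suc (suc a)) (suc (suc b)) =
    cong₂ _∧_ (symmetric a b)
              (cong₂ (λ p q → not p ∧ not q) (samePair-swapˡ a b s t) (samePair-swapˡ a b v w))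
  irreflexive′ : ∀ a → G′ a a ≡ false
  irreflexive′ zero          = refl
  irreflexive′ (suc zero)    = refl
  irreflexive′ (suc (suc a)) = cong (_∧ _) (irreflexive a)

module _ {n} {G : Graph n} (simple : IsSimple G) {s t v w : Fin n}
         (Gst≡true : G s t ≡ true) (Gvw≡true : G v w ≡ true)
         (distinct : samePair s t v w ≡ false) where

  private
    G′ = edgeJoinGraph G s t v w
    G₋ = removeEdge G s t
    G₋₋ = removeEdge G₋ v w

  deg-edgeJoin-old : ∀ c → deg G′ (suc (suc c)) ≡ deg G c
  deg-edgeJoin-old c = begin
    deg G′ (suc (suc c))
      ≡⟨ deg≡count G′ (suc (suc c)) ⟩
    X + (Y + count (λ b → G c b ∧ not (samePair c b s t) ∧ not (samePair c b v w)))
      ≡⟨ cong (λ m → X + (Y + m))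
              (trans (count-cong (λ b → sym (∧-assoc (G c b) _ _))) (sym (deg≡count G₋₋ c))) ⟩
    X + (Y + deg G₋₋ c)  ≡⟨ solve 3 (λ x y d → x :+ (y :+ d) := d :+ y :+ x) refl X Y (deg G₋₋ c) ⟩
    deg G₋₋ c + Y + X    ≡⟨ cong (_+ X) (deg-removeEdge (removeEdge-simple s t simple) G₋vw≡true c) ⟨
    deg G₋ c + X         ≡⟨ deg-removeEdge simple Gst≡true c ⟨
    deg G c              ∎
    where
    open ≡-Reasoning
    X = b2n (eqb c s ∨ eqb c t)
    Y = b2n (eqb c v ∨ eqb c w)
    G₋vw≡true : G₋ v w ≡ true
    G₋vw≡true = cong₂ (λ e p → e ∧ not p) Gvw≡true (trans (samePair-comm v w s t) distinct)

  edgeJoin-cubic : Cubic G → Cubic G′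
  edgeJoin-cubic cubic zero =
    trans (deg≡count G′ zero) (cong suc (count-≟-∨ (adjacent⇒≢ simple Gst≡true)))
  edgeJoin-cubic cubic (suc zero) =
    trans (deg≡count G′ (suc zero)) (cong suc (count-≟-∨ (adjacent⇒≢ simple Gvw≡true)))
  edgeJoin-cubic cubic (suc (suc c)) = trans (deg-edgeJoin-old c) (cubic c)

nbhd3-adjacent : ∀ {n} {G : Graph n} {v x y z} → IsSimple G → Nbhd3 G v x y z →
  ∀ u → G u v ≡ (eqb u x ∨ eqb u y ∨ eqb u z)
nbhd3-adjacent {G = G} {v} {x} {y} {z} (symmetric , _) (_ , _ , _ , _ , N) u
  with u Fin.≟ x | u Fin.≟ y | u Fin.≟ z
... | yes refl | _        | _        = trans (symmetric u v) (proj₂ (N u) (inj₁ refl))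
... | no _     | yes refl | _        = trans (symmetric u v) (proj₂ (N u) (inj₂ (inj₁ refl)))
... | no _     | no _     | yes refl = trans (symmetric u v) (proj₂ (N u) (inj₂ (inj₂ refl)))
... | no u≢x   | no u≢y   | no u≢z   = trans (symmetric u v) non-neighbour
  where
  non-neighbour : G v u ≡ false
  non-neighbour with G v u in Gvu
  ... | false = refl
  ... | true with proj₁ (N u) Gvu
  ...   | inj₁ u≡x        = ⊥-elim (u≢x u≡x)
  ...   | inj₂ (inj₁ u≡y) = ⊥-elim (u≢y u≡y)
  ...   | inj₂ (inj₂ u≡z) = ⊥-elim (u≢z u≡z)

nbhd3-center : ∀ {n} {G : Graph n} {v x y z} → IsSimple G → Nbhd3 G v x y z →
  (eqb v x ∨ eqb v y ∨ eqb v z) ≡ false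
nbhd3-center {v = v} simple N = trans (sym (nbhd3-adjacent simple N v)) (proj₂ simple v)

-- The local function match of bridgeGraph: the edges x₁x₂, y₁y₂, z₁z₂ added by a bridge.
matching : ∀ {a b} (x y z : Fin a) (x′ y′ z′ : Fin b) → Fin a → Fin b → Bool
matching x y z x′ y′ z′ p q = (eqb p x ∧ eqb q x′) ∨ (eqb p y ∧ eqb q y′) ∨ (eqb p z ∧ eqb q z′)

matching-transpose : ∀ {a b} (x y z : Fin a) (x′ y′ z′ : Fin b) p q →
  matching x y z x′ y′ z′ p q ≡ matching x′ y′ z′ x y z q p
matching-transpose x y z x′ y′ z′ p q
  rewrite ∧-comm (eqb p x) (eqb q x′) | ∧-comm (eqb p y) (eqb q y′) | ∧-comm (eqb p z) (eqb q z′) = refl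

matching-unmatched : ∀ {a b} {x y z : Fin a} (x′ y′ z′ : Fin b) {p} →
  (eqb p x ∨ eqb p y ∨ eqb p z) ≡ false → ∀ q → matching x y z x′ y′ z′ p q ≡ false
matching-unmatched {x = x} {y} {z} x′ y′ z′ {p} unmatched q with eqb p x | eqb p y | eqb p z
... | false | false | false = refl
matching-unmatched _ _ _ () _ | true  | _     | _
matching-unmatched _ _ _ () _ | false | true  | _
matching-unmatched _ _ _ () _ | false | false | true

count-matching : ∀ {a b} {x y z : Fin a} (x′ y′ z′ : Fin b) → x ≢ y → x ≢ z → y ≢ z →
  ∀ p → count (matching x y z x′ y′ z′ p) ≡ b2n (eqb p x ∨ eqb p y ∨ eqb p z)
count-matching {x = x} {y} {z} x′ y′ z′ x≢y x≢z y≢z p = begin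
  count (λ q → X q ∨ Y q ∨ Z q)               ≡⟨ count-cong (λ q → sym (∨-assoc (X q) _ _)) ⟩
  count (λ q → (X q ∨ Y q) ∨ Z q)
    ≡⟨ count-∨ (λ q → X q ∨ Y q) Z (λ q → ∨-∧-false (X q) _ _
         (∧-∧-false (eqb p x) _ _ _ (eqb-disjoint x≢z p)) (∧-∧-false (eqb p y) _ _ _ (eqb-disjoint y≢z p))) ⟩
  count (λ q → X q ∨ Y q) + count Z
    ≡⟨ cong (_+ count Z) (count-∨ X Y (λ q → ∧-∧-false (eqb p x) _ _ _ (eqb-disjoint x≢y p))) ⟩
  count X + count Y + count Z
    ≡⟨ cong₂ _+_ (cong₂ _+_ (count-∧-≟ (eqb p x) x′) (count-∧-≟ (eqb p y) y′))
                 (count-∧-≟ (eqb p z) z′) ⟩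
  b2n (eqb p x) + b2n (eqb p y) + b2n (eqb p z)
    ≡⟨ cong (_+ b2n (eqb p z)) (b2n-∨ (eqb p x) _ (eqb-disjoint x≢y p)) ⟨
  b2n (eqb p x ∨ eqb p y) + b2n (eqb p z)
    ≡⟨ b2n-∨-∨ (eqb p x) _ _ (eqb-disjoint x≢z p) (eqb-disjoint y≢z p) ⟨
  b2n (eqb p x ∨ eqb p y ∨ eqb p z)           ∎
  where
  open ≡-Reasoning
  X Y Z : _ → Bool
  X q = eqb p x ∧ eqb q x′
  Y q = eqb p y ∧ eqb q y′
  Z q = eqb p z ∧ eqb q z′

nbhd3-count-matching : ∀ {n k} {G : Graph n} {v x y z} → IsSimple G → Nbhd3 G v x y z →
  ∀ (x′ y′ z′ : Fin k) u → count (matching x y z x′ y′ z′ u) ≡ b2n (G u v)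
nbhd3-count-matching simple N@(_ , x≢y , x≢z , y≢z , _) x′ y′ z′ u =
  trans (count-matching x′ y′ z′ x≢y x≢z y≢z u) (cong b2n (sym (nbhd3-adjacent simple N u)))

deg-rewire : ∀ {m k} (G : Graph (suc m)) u v (h : Fin (suc k) → Bool) v′ →
  h v′ ≡ false → count h ≡ b2n (G u v) →
  count (G u ∘ punchIn v) + count (h ∘ punchIn v′) ≡ deg G u
deg-rewire G u v h v′ hv′≡false count-h = begin
  count (G u ∘ punchIn v) + count (h ∘ punchIn v′)
    ≡⟨ cong (_+_ (count (G u ∘ punchIn v))) (trans (count-punchIn-false {f = h} v′ hv′≡false) count-h) ⟩
  count (G u ∘ punchIn v) + b2n (G u v)             ≡⟨ +-comm _ (b2n (G u v)) ⟩
  b2n (G u v) + count (G u ∘ punchIn v)             ≡⟨ count-remove (G u) v ⟨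
  count (G u)                                       ≡⟨ deg≡count G u ⟨
  deg G u                                           ∎
  where open ≡-Reasoning

bridge-simple : ∀ {a b} {G₁ : Graph (suc a)} {G₂ : Graph (suc b)} v₁ x₁ y₁ z₁ v₂ x₂ y₂ z₂ →
  IsSimple G₁ → IsSimple G₂ → IsSimple (bridgeGraph G₁ v₁ x₁ y₁ z₁ G₂ v₂ x₂ y₂ z₂)
bridge-simple {a} {G₁ = G₁} {G₂} v₁ x₁ y₁ z₁ v₂ x₂ y₂ z₂
              (symmetric₁ , irreflexive₁) (symmetric₂ , irreflexive₂) = symmetric , irreflexive
  where
  R = bridgeGraph G₁ v₁ x₁ y₁ z₁ G₂ v₂ x₂ y₂ z₂
  symmetric : ∀ u w → R u w ≡ R w u
  symmetric u w with splitAt a u | splitAt a w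
  ... | inj₁ p | inj₁ q = symmetric₁ _ _
  ... | inj₁ p | inj₂ q = refl
  ... | inj₂ p | inj₁ q = refl
  ... | inj₂ p | inj₂ q = symmetric₂ _ _
  irreflexive : ∀ u → R u u ≡ false
  irreflexive u with splitAt a u
  ... | inj₁ p = irreflexive₁ _
  ... | inj₂ p = irreflexive₂ _

module _ {a b} {G₁ : Graph (suc a)} {G₂ : Graph (suc b)}
         (simple₁ : IsSimple G₁) (simple₂ : IsSimple G₂)
         {v₁ x₁ y₁ z₁} (N₁ : Nbhd3 G₁ v₁ x₁ y₁ z₁) {v₂ x₂ y₂ z₂} (N₂ : Nbhd3 G₂ v₂ x₂ y₂ z₂) where

  private
    R = bridgeGraph G₁ v₁ x₁ y₁ z₁ G₂ v₂ x₂ y₂ z₂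
    M = matching x₁ y₁ z₁ x₂ y₂ z₂

  deg-bridge-left : ∀ i → deg R (i ↑ˡ b) ≡ deg G₁ (punchIn v₁ i)
  deg-bridge-left i = begin
    deg R (i ↑ˡ b)      ≡⟨ deg≡count R (i ↑ˡ b) ⟩
    count (R (i ↑ˡ b))  ≡⟨ count-splitAt a (R (i ↑ˡ b)) ⟩
    count (λ j → R (i ↑ˡ b) (j ↑ˡ b)) + count (λ j → R (i ↑ˡ b) (a ↑ʳ j))
      ≡⟨ cong₂ _+_ (count-cong within) (count-cong across) ⟩
    count (G₁ u ∘ punchIn v₁) + count (M u ∘ punchIn v₂)
      ≡⟨ deg-rewire G₁ u v₁ (M u) v₂ M[u,v₂]≡false
           (nbhd3-count-matching simple₁ N₁ x₂ y₂ z₂ u) ⟩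
    deg G₁ u
      ∎
    where
    open ≡-Reasoning
    u = punchIn v₁ i
    within : ∀ j → R (i ↑ˡ b) (j ↑ˡ b) ≡ G₁ u (punchIn v₁ j)
    within j rewrite splitAt-↑ˡ a i b | splitAt-↑ˡ a j b = refl
    across : ∀ j → R (i ↑ˡ b) (a ↑ʳ j) ≡ M u (punchIn v₂ j)
    across j rewrite splitAt-↑ˡ a i b | splitAt-↑ʳ a b j = refl
    M[u,v₂]≡false : M u v₂ ≡ false
    M[u,v₂]≡false = trans (matching-transpose x₁ y₁ z₁ x₂ y₂ z₂ u v₂)
                          (matching-unmatched {x = x₂} {y₂} {z₂} x₁ y₁ z₁ {v₂} (nbhd3-center simple₂ N₂) u)

  deg-bridge-right : ∀ j → deg R (a ↑ʳ j) ≡ deg G₂ (punchIn v₂ j)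
  deg-bridge-right j = begin
    deg R (a ↑ʳ j)      ≡⟨ deg≡count R (a ↑ʳ j) ⟩
    count (R (a ↑ʳ j))  ≡⟨ count-splitAt a (R (a ↑ʳ j)) ⟩
    count (λ i → R (a ↑ʳ j) (i ↑ˡ b)) + count (λ i → R (a ↑ʳ j) (a ↑ʳ i))
      ≡⟨ cong₂ _+_ (count-cong across) (count-cong within) ⟩
    count (M′ u ∘ punchIn v₁) + count (G₂ u ∘ punchIn v₂)
      ≡⟨ +-comm (count (M′ u ∘ punchIn v₁)) _ ⟩
    count (G₂ u ∘ punchIn v₂) + count (M′ u ∘ punchIn v₁)
      ≡⟨ deg-rewire G₂ u v₂ (M′ u) v₁ M′[u,v₁]≡false
           (nbhd3-count-matching simple₂ N₂ x₁ y₁ z₁ u) ⟩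
    deg G₂ u
      ∎
    where
    open ≡-Reasoning
    u = punchIn v₂ j
    M′ = matching x₂ y₂ z₂ x₁ y₁ z₁
    within : ∀ i → R (a ↑ʳ j) (a ↑ʳ i) ≡ G₂ u (punchIn v₂ i)
    within i rewrite splitAt-↑ʳ a b j | splitAt-↑ʳ a b i = refl
    across : ∀ i → R (a ↑ʳ j) (i ↑ˡ b) ≡ M′ u (punchIn v₁ i)
    across i rewrite splitAt-↑ʳ a b j | splitAt-↑ˡ a i b =
      matching-transpose x₁ y₁ z₁ x₂ y₂ z₂ (punchIn v₁ i) u
    M′[u,v₁]≡false : M′ u v₁ ≡ false
    M′[u,v₁]≡false = trans (matching-transpose x₂ y₂ z₂ x₁ y₁ z₁ u v₁)
                           (matching-unmatched {x = x₁} {y₁} {z₁} x₂ y₂ z₂ {v₁} (nbhd3-center simple₁ N₁) u)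

  bridge-invariant : ∀ {p₁ p₂} → Invariant G₁ p₁ → Invariant G₂ p₂ → Invariant R (p₁ + p₂)
  bridge-invariant {p₁} {p₂} inv₁ inv₂ = record
    { simple    = bridge-simple v₁ x₁ y₁ z₁ v₂ x₂ y₂ z₂ simple₁ simple₂
    ; 3≤deg     = splitAt-elim (λ i → subst (3 ≤_) (sym (deg-bridge-left i)) (Invariant.3≤deg inv₁ _))
                               (λ j → subst (3 ≤_) (sym (deg-bridge-right j)) (Invariant.3≤deg inv₂ _))
    ; #deg3+p≡n = begin
        #deg3 R + (p₁ + p₂)    ≡⟨ cong (_+ (p₁ + p₂)) #deg3-bridge ⟩
        X₁ + X₂ + (p₁ + p₂)    ≡⟨ interchange X₁ X₂ p₁ p₂ ⟩
        (X₁ + p₁) + (X₂ + p₂)  ≡⟨ cong₂ _+_ (side G₁ v₁ (proj₁ N₁) inv₁) (side G₂ v₂ (proj₁ N₂) inv₂) ⟩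
        a + b                  ∎
    }
    where
    open ≡-Reasoning
    X₁ = count (λ i → deg G₁ (punchIn v₁ i) ≡ᵇ 3)
    X₂ = count (λ j → deg G₂ (punchIn v₂ j) ≡ᵇ 3)
    #deg3-bridge : #deg3 R ≡ X₁ + X₂
    #deg3-bridge = trans (count-splitAt a (λ w → deg R w ≡ᵇ 3))
                         (cong₂ _+_ (count-cong (cong (_≡ᵇ 3) ∘ deg-bridge-left))
                                    (count-cong (cong (_≡ᵇ 3) ∘ deg-bridge-right)))
    side : ∀ {m} (G : Graph (suc m)) v → deg G v ≡ 3 → ∀ {p} → Invariant G p →
      count (λ i → deg G (punchIn v i) ≡ᵇ 3) + p ≡ m
    side G v deg[v]≡3 {p} inv = suc-injective (begin
      suc (count (λ i → deg G (punchIn v i) ≡ᵇ 3) + p)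
        ≡⟨ cong (λ d → b2n (d ≡ᵇ 3) + count (λ i → deg G (punchIn v i) ≡ᵇ 3) + p) deg[v]≡3 ⟨
      b2n (deg G v ≡ᵇ 3) + count (λ i → deg G (punchIn v i) ≡ᵇ 3) + p
        ≡⟨ cong (_+ p) (count-remove (λ w → deg G w ≡ᵇ 3) v) ⟨
      #deg3 G + p
        ≡⟨ Invariant.#deg3+p≡n inv ⟩
      suc _ ∎)

construction-invariant : ∀ {n G j t p s} → Construction n G j t p s → Invariant G p
construction-invariant k4 = cubic⇒invariant K4-simple K4-cubic
construction-invariant (iso C G≅H) = iso-invariant G≅H (construction-invariant C)
construction-invariant (bridge C₁ C₂ _ _ _ _ N₁ _ _ _ _ N₂) =
  bridge-invariant (Invariant.simple inv₁) (Invariant.simple inv₂) N₁ N₂ inv₁ inv₂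
  where
  inv₁ = construction-invariant C₁
  inv₂ = construction-invariant C₂
construction-invariant (edgeJoin C cubic s t v w Gst≡true Gvw≡true distinct) =
  subst (Invariant _) (sym (invariant-cubic⇒p≡0 inv cubic))
        (cubic⇒invariant (edgeJoin-simple s t v w simple)
                         (edgeJoin-cubic simple Gst≡true Gvw≡true distinct cubic))
  where
  inv = construction-invariant C
  simple = Invariant.simple inv
construction-invariant (primarySpoke {G = G} {p = p} C v w x v≢w v≢x w≢x Gvw≡true _ deg[x]≡3) =
  subst (λ b → Invariant (spokeGraph G v w x) (b2n b + p)) (cong (_≡ᵇ 3) deg[x]≡3)
        (spoke-invariant (Invariant.simple inv) v≢w v≢x w≢x Gvw≡true inv)
  where inv = construction-invariant C
construction-invariant (secondarySpoke {G = G} {p = p} C v w x v≢w v≢x w≢x Gvw≡true _ 3<deg[x]) =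
  subst (λ b → Invariant (spokeGraph G v w x) (b2n b + p)) (dec-false (deg G x ≟ 3) (>⇒≢ 3<deg[x]))
        (spoke-invariant (Invariant.simple inv) v≢w v≢x w≢x Gvw≡true inv)
  where inv = construction-invariant C

construction-size : ∀ {n G j t p s} → Construction n G j t p s → n ≡ 4 + 2 * j + 2 * t + p + s
construction-size k4 = refl
construction-size (iso C _) = construction-size C
construction-size (bridge {a} {b} {j₁ = j₁} {t₁} {p₁} {s₁} {j₂} {t₂} {p₂} {s₂} C₁ C₂ _ _ _ _ _ _ _ _ _ _) = begin
  a + b
    ≡⟨ cong₂ _+_ (suc-injective (construction-size C₁)) (suc-injective (construction-size C₂)) ⟩
  (3 + 2 * j₁ + 2 * t₁ + p₁ + s₁) + (3 + 2 * j₂ + 2 * t₂ + p₂ + s₂)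
    ≡⟨ solve 8 (λ j₁ t₁ p₁ s₁ j₂ t₂ p₂ s₂ →
           (con 3 :+ con 2 :* j₁ :+ con 2 :* t₁ :+ p₁ :+ s₁)
             :+ (con 3 :+ con 2 :* j₂ :+ con 2 :* t₂ :+ p₂ :+ s₂)
         := con 4 :+ con 2 :* (con 1 :+ (j₁ :+ j₂)) :+ con 2 :* (t₁ :+ t₂) :+ (p₁ :+ p₂) :+ (s₁ :+ s₂))
       refl j₁ t₁ p₁ s₁ j₂ t₂ p₂ s₂ ⟩
  4 + 2 * suc (j₁ + j₂) + 2 * (t₁ + t₂) + (p₁ + p₂) + (s₁ + s₂)
    ∎
  where open ≡-Reasoning
construction-size (edgeJoin {j = j} {t} {p} {s} C _ _ _ _ _ _ _ _) =
  trans (cong (_+_ 2) (construction-size C))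
        (solve 4 (λ j t p s → con 2 :+ (con 4 :+ con 2 :* j :+ con 2 :* t :+ p :+ s)
                                := con 4 :+ con 2 :* j :+ con 2 :* (con 1 :+ t) :+ p :+ s) refl j t p s)
construction-size (primarySpoke {j = j} {t} {p} {s} C _ _ _ _ _ _ _ _ _) =
  trans (cong suc (construction-size C))
        (solve 4 (λ j t p s → con 1 :+ (con 4 :+ con 2 :* j :+ con 2 :* t :+ p :+ s)
                                := con 4 :+ con 2 :* j :+ con 2 :* t :+ (con 1 :+ p) :+ s) refl j t p s)
construction-size (secondarySpoke {j = j} {t} {p} {s} C _ _ _ _ _ _ _ _ _) =
  trans (cong suc (construction-size C)) (sym (+-suc (4 + 2 * j + 2 * t + p) s))

primary≤1+bridges : ∀ {n G j t p s} → Construction n G j t p s → p ≤ suc j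
primary≤1+bridges k4 = z≤n
primary≤1+bridges (iso C _) = primary≤1+bridges C
primary≤1+bridges (bridge {j₁ = j₁} {j₂ = j₂} C₁ C₂ _ _ _ _ _ _ _ _ _ _) =
  ≤-trans (+-mono-≤ (primary≤1+bridges C₁) (primary≤1+bridges C₂)) (≤-reflexive (cong suc (+-suc j₁ j₂)))
primary≤1+bridges (edgeJoin C _ _ _ _ _ _ _ _) = primary≤1+bridges C
primary≤1+bridges (secondarySpoke C _ _ _ _ _ _ _ _ _) = primary≤1+bridges C
primary≤1+bridges (primarySpoke {G = G} {j = j} C _ _ x _ _ _ _ deg≡3-off-x deg[x]≡3) =
  s≤s (subst (_≤ j) (sym (invariant-cubic⇒p≡0 (construction-invariant C) cubic)) z≤n)
  where
  cubic : Cubic G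
  cubic z with z Fin.≟ x
  ... | yes refl = deg[x]≡3
  ... | no z≢x   = deg≡3-off-x z z≢x

foldr-⊓-glb : ∀ {A : Set} (f : A → ℕ) {d init} → d ≤ init → (∀ x → d ≤ f x) →
  ∀ xs → d ≤ List.foldr (λ x m → f x ⊓ m) init xs
foldr-⊓-glb f d≤init d≤f []       = d≤init
foldr-⊓-glb f d≤init d≤f (x ∷ xs) = ⊓-glb (d≤f x) (foldr-⊓-glb f d≤init d≤f xs)

foldr-⊓-lb : ∀ {A : Set} (f : A → ℕ) init {x xs} → x ∈ xs → List.foldr (λ x m → f x ⊓ m) init xs ≤ f x
foldr-⊓-lb f init (here refl) = m⊓n≤m _ _
foldr-⊓-lb f init (there x∈xs) = ≤-trans (m⊓n≤n _ _) (foldr-⊓-lb f init x∈xs)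

minDeg-≡ : ∀ {n} {G : Graph n} {d} w → d ≤ n → (∀ v → d ≤ deg G v) → deg G w ≡ d → minDeg G ≡ d
minDeg-≡ {n} {G} w d≤n d≤deg deg[w]≡d =
  ≤-antisym (≤-trans (foldr-⊓-lb (deg G) n (∈-allFin w)) (≤-reflexive deg[w]≡d))
            (foldr-⊓-glb (deg G) d≤n d≤deg (List.allFin n))

length-filter : ∀ {A : Set} {P : Pred A 0ℓ} (P? : Decidable P) xs →
  List.length (List.filter P? xs) ≡ ListAction.sum (List.map (b2n ∘ does ∘ P?) xs)
length-filter P? []       = refl
length-filter P? (x ∷ xs) with does (P? x)
... | true  = cong suc (length-filter P? xs)
... | false = length-filter P? xs

ν≡#deg3 : ∀ {n} {G : Graph n} {p} → Invariant G p → p < n → 3 ≤ n → ν G ≡ #deg3 G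
ν≡#deg3 {n} {G} {p} inv p<n 3≤n = begin
  ν G                                                ≡⟨ length-filter (λ v → deg G v ≟ minDeg G) (List.allFin n) ⟩
  ListAction.sum (List.map deg≡min (List.allFin n))  ≡⟨ sum-map-allFin deg≡min ⟩
  count (λ v → deg G v ≡ᵇ minDeg G)                  ≡⟨ cong (λ d → count (λ v → deg G v ≡ᵇ d)) minDeg≡3 ⟩
  #deg3 G                                            ∎
  where
  open ≡-Reasoning
  open Invariant inv using (3≤deg; #deg3+p≡n)
  deg≡min : Fin n → ℕ
  deg≡min v = b2n (deg G v ≡ᵇ minDeg G)
  0<#deg3 : 0 < #deg3 G
  0<#deg3 = n≢0⇒n>0 λ #deg3≡0 → <⇒≢ p<n (trans (sym (cong (_+ p) #deg3≡0)) #deg3+p≡n)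
  minDeg≡3 : minDeg G ≡ 3
  minDeg≡3 = let (w , w-deg3) = count-pos _ 0<#deg3 in
    minDeg-≡ w 3≤n 3≤deg (≡ᵇ⇒≡ _ 3 (Equivalence.from T-≡ w-deg3))

[m+kn]/n≡k : ∀ m k n .{{_ : NonZero n}} → m < n → (m + k * n) / n ≡ k
[m+kn]/n≡k m k n m<n = trans (+-distrib-/-∣ʳ m (divides-refl k)) (cong₂ _+_ (m<n⇒m/n≡0 m<n) (m*n/n≡m k n))

⌈2[3m+5+r]+2/3⌉≡2m+4+r : ∀ m r → r ≤ 2 → ⌈ 2 * (3 * m + 5 + r) + 2 /3⌉ ≡ 2 * m + 4 + r
⌈2[3m+5+r]+2/3⌉≡2m+4+r m r r≤2 =
  trans (/-congˡ (numerator r r≤2)) ([m+kn]/n≡k (2 ∸ r) (2 * m + 4 + r) 3 (s≤s (m∸n≤m 2 r)))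
  where
  numerator : ∀ r → r ≤ 2 → 2 * (3 * m + 5 + r) + 2 + 2 ≡ 2 ∸ r + (2 * m + 4 + r) * 3
  numerator 0 _ = solve 1 (λ m → con 2 :* (con 3 :* m :+ con 5 :+ con 0) :+ con 2 :+ con 2
                                   := con 2 :+ (con 2 :* m :+ con 4 :+ con 0) :* con 3) refl m
  numerator 1 _ = solve 1 (λ m → con 2 :* (con 3 :* m :+ con 5 :+ con 1) :+ con 2 :+ con 2
                                   := con 1 :+ (con 2 :* m :+ con 4 :+ con 1) :* con 3) refl m
  numerator 2 _ = solve 1 (λ m → con 2 :* (con 3 :* m :+ con 5 :+ con 2) :+ con 2 :+ con 2
                                   := con 0 :+ (con 2 :* m :+ con 4 :+ con 2) :* con 3) refl m
  numerator (suc (suc (suc _))) (s≤s (s≤s ()))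

-- Writing ℓ = r − 1 with r ∈ {0, 1, 2} moves the rest of the argument to ℕ.
+n≡+k+[r-1]⇒1+n≡k+r : ∀ {n k} r → + n ≡ + k ℤ.+ (+ r ℤ.- 1ℤ) → suc n ≡ k + r
+n≡+k+[r-1]⇒1+n≡k+r {n} {k} r eq = ℤ.+-injective (begin
  1ℤ ℤ.+ + n                     ≡⟨ cong (ℤ._+_ 1ℤ) eq ⟩
  1ℤ ℤ.+ (+ k ℤ.+ (+ r ℤ.- 1ℤ))
    ≡⟨ solveℤ 2 (λ k r → con 1ℤ ⊕ (k ⊕ (r :- con 1ℤ)) ⊜ k ⊕ r) refl (+ k) (+ r) ⟩
  + k ℤ.+ + r                    ∎)
  where
  open ≡-Reasoning
  open ℤ-Solver using (_:-_; con) renaming (solve to solveℤ; _:+_ to _⊕_; _:=_ to _⊜_)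

1+n≡3k+r⇒n≡3m+5+r : ∀ {n k r} → suc n ≡ 3 * k + r → r ≤ 2 → 5 ≤ n → k ≢ 1 →
  ∃[ m ] k ≡ 2 + m × n ≡ 3 * m + 5 + r
1+n≡3k+r⇒n≡3m+5+r {k = zero} eq r≤2 5≤n _ =
  ⊥-elim (≤⇒≯ r≤2 (subst (2 <_) eq (s≤s (≤-trans (s≤s (s≤s z≤n)) 5≤n))))
1+n≡3k+r⇒n≡3m+5+r {k = suc zero} _ _ _ k≢1 = ⊥-elim (k≢1 refl)
1+n≡3k+r⇒n≡3m+5+r {k = suc (suc m)} {r} eq _ _ _ =
  m , refl , suc-injective (trans eq (solve 2 (λ m r → con 3 :* (con 2 :+ m) :+ r
                                                    := con 1 :+ (con 3 :* m :+ con 5 :+ r)) refl m r))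

extremal-counts : ∀ {n} {G : Graph n} {j t p s} → Construction n G j t p s → ν G ≡ ⌈ 2 * n + 2 /3⌉ →
  ∀ m r → r ≤ 2 → n ≡ 3 * m + 5 + r → p ≡ suc m × ∃[ d ] j ≡ m + d × r ≡ 2 * d + 2 * t + s
extremal-counts {G = G} {j} {t} {p} {s} C ν≡⌈2n+2/3⌉ m r r≤2 refl = p≡1+m , d , sym m+d≡j , r≡2d+2t+s
  where
  open ≡-Reasoning
  open Invariant (construction-invariant C) using (#deg3+p≡n)
  size = construction-size C
  p<n : p < 3 * m + 5 + r
  p<n = ≤-trans (m<n+m p {4 + 2 * j + 2 * t} (s≤s z≤n)) (≤-trans (m≤m+n _ s) (≤-reflexive (sym size)))
  3≤n : 3 ≤ 3 * m + 5 + r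
  3≤n = ≤-trans (s≤s (s≤s (s≤s z≤n))) (≤-trans (m≤n+m 5 (3 * m)) (m≤m+n _ r))
  #deg3≡2m+4+r : #deg3 G ≡ 2 * m + 4 + r
  #deg3≡2m+4+r = trans (sym (ν≡#deg3 (construction-invariant C) p<n 3≤n))
                       (trans ν≡⌈2n+2/3⌉ (⌈2[3m+5+r]+2/3⌉≡2m+4+r m r r≤2))
  p≡1+m : p ≡ suc m
  p≡1+m = +-cancelˡ-≡ (2 * m + 4 + r) p (suc m) (begin
    2 * m + 4 + r + p      ≡⟨ cong (_+ p) #deg3≡2m+4+r ⟨
    #deg3 G + p            ≡⟨ #deg3+p≡n ⟩
    3 * m + 5 + r
      ≡⟨ solve 2 (λ m r → con 3 :* m :+ con 5 :+ r := con 2 :* m :+ con 4 :+ r :+ (con 1 :+ m)) refl m r ⟩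
    2 * m + 4 + r + suc m  ∎)
  m≤j : m ≤ j
  m≤j = s≤s⁻¹ (subst (_≤ suc j) p≡1+m (primary≤1+bridges C))
  d = proj₁ (m≤n⇒∃[o]m+o≡n m≤j)
  m+d≡j : m + d ≡ j
  m+d≡j = proj₂ (m≤n⇒∃[o]m+o≡n m≤j)
  r≡2d+2t+s : r ≡ 2 * d + 2 * t + s
  r≡2d+2t+s = +-cancelˡ-≡ (3 * m + 5) r _ (begin
    3 * m + 5 + r                       ≡⟨ size ⟩
    4 + 2 * j + 2 * t + p + s           ≡⟨ cong₂ (λ j p → 4 + 2 * j + 2 * t + p + s) (sym m+d≡j) p≡1+m ⟩
    4 + 2 * (m + d) + 2 * t + suc m + s
      ≡⟨ solve 4 (λ m d t s → con 4 :+ con 2 :* (m :+ d) :+ con 2 :* t :+ (con 1 :+ m) :+ s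
                              := con 3 :* m :+ con 5 :+ (con 2 :* d :+ con 2 :* t :+ s)) refl m d t s ⟩
    3 * m + 5 + (2 * d + 2 * t + s)     ∎)

extremal-counts-residue : ∀ {n} {G : Graph n} {j t p s k} r → Construction n G j t p s →
  ν G ≡ ⌈ 2 * n + 2 /3⌉ → k ≢ 1 → 5 ≤ n → r ≤ 2 → + n ≡ + (3 * k) ℤ.+ (+ r ℤ.- 1ℤ) →
  ∃[ m ] k ≡ 2 + m × p ≡ suc m × ∃[ d ] j ≡ m + d × r ≡ 2 * d + 2 * t + s
extremal-counts-residue r C ν≡⌈2n+2/3⌉ k≢1 5≤n r≤2 n≡3k+r-1
  with 1+n≡3k+r⇒n≡3m+5+r (+n≡+k+[r-1]⇒1+n≡k+r r n≡3k+r-1) r≤2 5≤n k≢1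
... | m , k≡2+m , n≡3m+5+r = m , k≡2+m , extremal-counts C ν≡⌈2n+2/3⌉ m r r≤2 n≡3m+5+r

2d+2t+s≡0 : ∀ d t s → 0 ≡ 2 * d + 2 * t + s → d ≡ 0 × t ≡ 0 × s ≡ 0
2d+2t+s≡0 zero zero s eq = refl , refl , sym eq

2d+2t+s≡1 : ∀ d t s → 1 ≡ 2 * d + 2 * t + s → d ≡ 0 × t ≡ 0 × s ≡ 1
2d+2t+s≡1 zero             zero             s eq = refl , refl , sym eq
2d+2t+s≡1 zero             (suc zero)       s ()
2d+2t+s≡1 zero             (suc (suc _))    s ()
2d+2t+s≡1 (suc zero)       t                s ()
2d+2t+s≡1 (suc (suc _))    t                s ()

2d+2t+s≡2 : ∀ d t s → 2 ≡ 2 * d + 2 * t + s →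
  (d ≡ 1 × t ≡ 0 × s ≡ 0) ⊎ (d ≡ 0 × t ≡ 1 × s ≡ 0) ⊎ (d ≡ 0 × t ≡ 0 × s ≡ 2)
2d+2t+s≡2 zero                zero                s        eq = inj₂ (inj₂ (refl , refl , sym eq))
2d+2t+s≡2 zero                (suc zero)          zero     _  = inj₂ (inj₁ (refl , refl , refl))
2d+2t+s≡2 zero                (suc zero)          (suc _)  ()
2d+2t+s≡2 zero                (suc (suc zero))    _        ()
2d+2t+s≡2 zero                (suc (suc (suc _))) _        ()
2d+2t+s≡2 (suc zero)          zero                zero     _  = inj₁ (refl , refl , refl)
2d+2t+s≡2 (suc zero)          zero                (suc _)  ()
2d+2t+s≡2 (suc zero)          (suc _)             _        ()
2d+2t+s≡2 (suc (suc zero))    _                   _        ()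
2d+2t+s≡2 (suc (suc (suc _))) _                   _        ()

theorem16 : (n : ℕ) (G : Graph n) → IsSimple G → Extremal G →
    (k : ℕ) (ℓ : ℤ) → k ≢ 1 → (ℓ ≡ -1ℤ ⊎ ℓ ≡ 0ℤ ⊎ ℓ ≡ 1ℤ) →
    + n ≡ Data.Integer._+_ (+ (3 Data.Nat.* k)) ℓ → 5 ≤ n →
    (j t p s : ℕ) → Construction n G j t p s →
    (p ≡ k ∸ 1)
    × (ℓ ≡ -1ℤ → j ≡ k ∸ 2 × t ≡ 0 × s ≡ 0)
    × (ℓ ≡ 0ℤ → j ≡ k ∸ 2 × t ≡ 0 × s ≡ 1)
    × (ℓ ≡ 1ℤ →
        (j ≡ k ∸ 1 × t ≡ 0 × s ≡ 0)
        ⊎ (j ≡ k ∸ 2 × t ≡ 1 × s ≡ 0)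
        ⊎ (j ≡ k ∸ 2 × t ≡ 0 × s ≡ 2))
theorem16 n G _ (_ , ν≡⌈2n+2/3⌉) k ℓ k≢1 (inj₁ refl) n≡3k+ℓ 5≤n j t p s C
  with extremal-counts-residue 0 C ν≡⌈2n+2/3⌉ k≢1 5≤n z≤n n≡3k+ℓ
... | m , refl , p≡1+m , d , refl , r≡2d+2t+s with 2d+2t+s≡0 d t s r≡2d+2t+s
...   | refl , refl , refl = p≡1+m , (λ _ → +-identityʳ m , refl , refl) , (λ ()) , (λ ())
theorem16 n G _ (_ , ν≡⌈2n+2/3⌉) k ℓ k≢1 (inj₂ (inj₁ refl)) n≡3k+ℓ 5≤n j t p s C
  with extremal-counts-residue 1 C ν≡⌈2n+2/3⌉ k≢1 5≤n (s≤s z≤n) n≡3k+ℓ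
... | m , refl , p≡1+m , d , refl , r≡2d+2t+s with 2d+2t+s≡1 d t s r≡2d+2t+s
...   | refl , refl , refl = p≡1+m , (λ ()) , (λ _ → +-identityʳ m , refl , refl) , (λ ())
theorem16 n G _ (_ , ν≡⌈2n+2/3⌉) k ℓ k≢1 (inj₂ (inj₂ refl)) n≡3k+ℓ 5≤n j t p s C
  with extremal-counts-residue 2 C ν≡⌈2n+2/3⌉ k≢1 5≤n (s≤s (s≤s z≤n)) n≡3k+ℓ
... | m , refl , p≡1+m , d , refl , r≡2d+2t+s with 2d+2t+s≡2 d t s r≡2d+2t+s
...   | inj₁ (refl , refl , refl)        = p≡1+m , (λ ()) , (λ ()) , λ _ → inj₁ (+-comm m 1 , refl , refl)
...   | inj₂ (inj₁ (refl , refl , refl)) =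
  p≡1+m , (λ ()) , (λ ()) , λ _ → inj₂ (inj₁ (+-identityʳ m , refl , refl))
...   | inj₂ (inj₂ (refl , refl , refl)) =
  p≡1+m , (λ ()) , (λ ()) , λ _ → inj₂ (inj₂ (+-identityʳ m , refl , refl))
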